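{- Let $P=\{\vec{p}_1,\ldots,\vec{p}_k\}\subseteq\mathbb{Q}^n$ with $k\in\mathbb{N}$. The interior of the monoid $P^*$ equals $\{\vec{0}\}$ if $k=0$, and equals $P^*\cap\big((\mathbb{Q}_+\setminus\{0\})\vec{p}_1+\cdots+(\mathbb{Q}_+\setminus\{0\})\vec{p}_k\big)$ if $k\geq1$.
   Context: A monoid of $\mathbb{Q}^n$ is a set $M\subseteq\mathbb{Q}^n$ with $\vec{0}\in M$ and $M+M\subseteq M$; $P^*$ denotes the smallest monoid containing $P$ (all finite sums of elements of $P$, including $\vec 0$). A vector $\vec{a}\in M$ is interior to $M$ if for every $\vec{x}\in M$ there exists an integer $N\geq1$ with $N\vec{a}\in\vec{x}+M$; the interior of $M$ is the set of its interior vectors. $\mathbb{Q}_+$ is the set of non-negative rationals, and sums of sets are Minkowski sums. -}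

module Defs where

open import Data.Nat using (ℕ; zero; suc; _≥_)
open import Data.Fin using (Fin)
import Data.Fin as F
open import Data.Vec using (Vec; zipWith; replicate; map; lookup; foldr)
open import Data.Rational using (ℚ; _+_; _*_; _<_; 0ℚ; _/_)
open import Data.Product using (Σ; ∃; _×_; _,_)
open import Data.Sum using (_⊎_)
open import Function.Bundles using (_⇔_)
open import Relation.Binary.PropositionalEquality using (_≡_)

ℚⁿ : ℕ → Set
ℚⁿ n = Vec ℚ n

𝟎 : ∀ {n} → ℚⁿ n
𝟎 = replicate _ 0ℚ

_⊕_ : ∀ {n} → ℚⁿ n → ℚⁿ n → ℚⁿ n
_⊕_ = zipWith _+_
infixl 6 _⊕_

_⊙_ : ∀ {n} → ℚ → ℚⁿ n → ℚⁿ n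
c ⊙ v = map (c *_) v
infixr 7 _⊙_

_·_ : ∀ {n} → ℕ → ℚⁿ n → ℚⁿ n
zero · a = 𝟎
suc N · a = a ⊕ (N · a)

Subset : ℕ → Set₁
Subset n = ℚⁿ n → Set

-- the set P = {p_1,...,p_k} is given by the list p : Fin k → ℚ^n.
-- P* : the smallest monoid containing P = all finite sums of elements of P.
data Star {n k : ℕ} (p : Fin k → ℚⁿ n) : ℚⁿ n → Set where
  star-zero : Star p 𝟎
  star-add  : ∀ (i : Fin k) {y} → Star p y → Star p (p i ⊕ y)

Interior : ∀ {n} → Subset n → Subset n
Interior {n} M a =
  M a × (∀ (x : ℚⁿ n) → M x →
           ∃ λ (N : ℕ) → N ≥ 1 × ∃ λ (y : ℚⁿ n) → M y × (N · a ≡ x ⊕ y))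

Σᵥ : ∀ {n k} → (Fin k → ℚⁿ n) → ℚⁿ n
Σᵥ {k = zero} v = 𝟎
Σᵥ {k = suc k} v = v F.zero ⊕ Σᵥ (λ i → v (F.suc i))

PosCone : ∀ {n k} → (Fin k → ℚⁿ n) → Subset n
PosCone {n} {k} p x =
  ∃ λ (c : Fin k → ℚ) → (∀ i → 0ℚ < c i) × (x ≡ Σᵥ (λ i → c i ⊙ p i))

_≐_ : ∀ {n} → Subset n → Subset n → Set
A ≐ B = ∀ x → A x ⇔ B x

module Submission where

-- Writing lin p c for the linear combination Σᵢ cᵢ pᵢ, the proof rests on
-- the description  P* = { lin p m : m ∈ ℕᵏ }  of the monoid as the set of
-- natural combinations of the generators.  With it both inclusions become
-- statements about coefficients:
--  * if a is interior, apply the definition to x = Σᵢ pᵢ ∈ P*: then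
--    N a = Σᵢ (1 + mᵢ) pᵢ for some N ≥ 1 and m ∈ ℕᵏ, so a = Σᵢ ((1 + mᵢ)/N) pᵢ
--    has strictly positive coefficients;
--  * if a ∈ P* and a = Σᵢ cᵢ pᵢ with all cᵢ > 0, then for any x = Σᵢ mᵢ pᵢ ∈ P*
--    some N ≥ 1 makes every N cᵢ a natural number ≥ mᵢ (clear denominators,
--    then scale past max mᵢ), hence N a = x + Σᵢ (N cᵢ - mᵢ) pᵢ ∈ x + P*.

open import Defs
open import Data.Nat as ℕ using (ℕ; zero; suc; _≥_; _≤_; s≤s; z≤n)
import Data.Nat.Properties as ℕ
open import Data.Fin using (Fin) renaming (zero to fzero; suc to fsuc)
open import Data.Vec using ([]; _∷_; replicate)
open import Data.Vec.Properties
  using (zipWith-assoc; zipWith-identityˡ; zipWith-identityʳ;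
         map-∘; map-cong; map-id; map-const; map-replicate)
open import Data.Integer as ℤ using (ℤ; +[1+_]; -[1+_])
open import Data.Rational
  using (ℚ; _+_; _*_; _<_; 0ℚ; 1ℚ; 1/_; mkℚ; toℚᵘ; Positive; NonNegative; NonZero; positive)
open import Data.Rational.Properties
open import Data.Rational.Unnormalised as ℚᵘ using (mkℚᵘ; *≡*)
import Data.Rational.Unnormalised.Properties as ℚᵘ
open import Data.Integer.Tactic.RingSolver using (solve-∀)
open import Algebra.Bundles using (CommutativeMonoid)
import Algebra.Properties.CommutativeSemigroup as CommSemigroupProperties
open import Data.Product using (∃; ∃₂; _,_; _×_; proj₁; proj₂)
open import Function using (const)
open import Function.Bundles using (mk⇔; Equivalence)
open import Relation.Binary.PropositionalEquality
open ≡-Reasoning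

ι : ℕ → ℚ
ι zero    = 0ℚ
ι (suc m) = 1ℚ + ι m

ι-+ : ∀ a b → ι (a ℕ.+ b) ≡ ι a + ι b
ι-+ zero    b = sym (+-identityˡ (ι b))
ι-+ (suc a) b = trans (cong (1ℚ +_) (ι-+ a b)) (sym (+-assoc 1ℚ (ι a) (ι b)))

ι-* : ∀ a b → ι (a ℕ.* b) ≡ ι a * ι b
ι-* zero    b = sym (*-zeroˡ (ι b))
ι-* (suc a) b = begin
  ι (b ℕ.+ a ℕ.* b)       ≡⟨ ι-+ b (a ℕ.* b) ⟩
  ι b + ι (a ℕ.* b)       ≡⟨ cong (ι b +_) (ι-* a b) ⟩
  ι b + ι a * ι b         ≡⟨ cong (_+ ι a * ι b) (sym (*-identityˡ (ι b))) ⟩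
  1ℚ * ι b + ι a * ι b    ≡⟨ sym (*-distribʳ-+ (ι b) 1ℚ (ι a)) ⟩
  (1ℚ + ι a) * ι b        ∎

ι-nonNeg : ∀ m → NonNegative (ι m)
ι-nonNeg zero    = _
ι-nonNeg (suc m) = pos⇒nonNeg (ι (suc m)) {{pos+nonNeg⇒pos 1ℚ (ι m) {{ι-nonNeg m}}}}

ι-suc-pos : ∀ m → Positive (ι (suc m))
ι-suc-pos m = pos+nonNeg⇒pos 1ℚ (ι m) {{ι-nonNeg m}}

-- On unnormalised rationals ι m is the fraction m/1; this is what lets us
-- compute with the numerator and denominator of a rational below.
ι-as-fraction : ∀ m → toℚᵘ (ι m) ℚᵘ.≃ mkℚᵘ (ℤ.+ m) 0
ι-as-fraction zero    = *≡* refl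
ι-as-fraction (suc m) = ℚᵘ.≃-trans (toℚᵘ-homo-+ 1ℚ (ι m))
  (ℚᵘ.≃-trans (ℚᵘ.+-congʳ (toℚᵘ 1ℚ) (ι-as-fraction m)) (*≡* (one-plus (ℤ.+ m))))
  where
  one-plus : ∀ (x : ℤ) → (ℤ.+ 1 ℤ.* ℤ.+ 1 ℤ.+ x ℤ.* ℤ.+ 1) ℤ.* ℤ.+ 1 ≡ (ℤ.+ 1 ℤ.+ x) ℤ.* (ℤ.+ 1 ℤ.* ℤ.+ 1)
  one-plus = solve-∀

-- A positive rational t⁺/d⁺ becomes the positive natural t⁺ when multiplied
-- by the positive natural d⁺ (its denominator).
clear-denominator : ∀ c → 0ℚ < c → ∃₂ λ d t → ι (suc d) * c ≡ ι (suc t)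
clear-denominator c@(mkℚ +[1+ t ] d _) _ = d , t , toℚᵘ-injective
  (ℚᵘ.≃-trans (toℚᵘ-homo-* (ι (suc d)) c)
  (ℚᵘ.≃-trans (ℚᵘ.*-congʳ (ι-as-fraction (suc d)))
  (ℚᵘ.≃-trans (*≡* (cross-multiply (suc d) +[1+ t ]))
  (ℚᵘ.≃-sym (ι-as-fraction (suc t))))))
  where
  swap : ∀ (x y : ℤ) → (x ℤ.* y) ℤ.* ℤ.+ 1 ≡ y ℤ.* x
  swap = solve-∀
  cross-multiply : ∀ e (y : ℤ) → (ℤ.+ e ℤ.* y) ℤ.* ℤ.+ 1 ≡ y ℤ.* ℤ.+ (1 ℕ.* e)
  cross-multiply e y = trans (swap (ℤ.+ e) y) (cong (λ z → y ℤ.* ℤ.+ z) (sym (ℕ.*-identityˡ e)))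
clear-denominator (mkℚ (ℤ.+ 0)   _ _) 0<c with () ← positive 0<c
clear-denominator (mkℚ -[1+ _ ]  _ _) 0<c with () ← positive 0<c

multiplier-scale : ∀ k a b {c} → ι a * c ≡ ι b → ι (k ℕ.* a) * c ≡ ι (k ℕ.* b)
multiplier-scale k a b {c} eq = begin
  ι (k ℕ.* a) * c    ≡⟨ cong (_* c) (ι-* k a) ⟩
  ι k * ι a * c      ≡⟨ *-assoc (ι k) (ι a) c ⟩
  ι k * (ι a * c)    ≡⟨ cong (ι k *_) eq ⟩
  ι k * ι b          ≡⟨ sym (ι-* k b) ⟩
  ι (k ℕ.* b)        ∎

common-denominator : ∀ {k} (c : Fin k → ℚ) → (∀ i → 0ℚ < c i) →
  ∃₂ λ E (q : Fin k → ℕ) → ∀ i → ι (suc E) * c i ≡ ι (suc (q i))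
common-denominator {zero}  c _   = 0 , (λ ()) , λ ()
common-denominator {suc k} c c>0
  with common-denominator (λ i → c (fsuc i)) (λ i → c>0 (fsuc i))
     | clear-denominator (c fzero) (c>0 fzero)
... | E , q , hq | d , t , h0 = E ℕ.+ d ℕ.* suc E , q′ , clears
  where
  q′ : Fin (suc k) → ℕ
  q′ fzero    = t ℕ.+ E ℕ.* suc t
  q′ (fsuc j) = q j ℕ.+ d ℕ.* suc (q j)
  clears : ∀ i → ι (suc d ℕ.* suc E) * c i ≡ ι (suc (q′ i))
  clears fzero    = trans (cong (λ e → ι e * c fzero) (ℕ.*-comm (suc d) (suc E)))
                          (multiplier-scale (suc E) (suc d) (suc t) h0)
  clears (fsuc j) = multiplier-scale (suc d) (suc E) (suc (q j)) (hq j)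

upper-bound : ∀ {k} (m : Fin k → ℕ) → ∃ λ B → ∀ i → m i ≤ B
upper-bound {zero}  m = 0 , λ ()
upper-bound {suc k} m with upper-bound (λ i → m (fsuc i))
... | B , m≤B = m fzero ℕ.+ B , bounded
  where
  bounded : ∀ i → m i ≤ m fzero ℕ.+ B
  bounded fzero    = ℕ.m≤m+n (m fzero) B
  bounded (fsuc j) = ℕ.≤-trans (m≤B j) (ℕ.m≤n+m B (m fzero))

dominating-multiple : ∀ {k} (c : Fin k → ℚ) → (∀ i → 0ℚ < c i) → (m : Fin k → ℕ) →
  ∃₂ λ N (r : Fin k → ℕ) → ∀ i → ι (suc N) * c i ≡ ι (m i ℕ.+ r i)
dominating-multiple c c>0 m with common-denominator c c>0 | upper-bound m
... | E , q , hq | B , m≤B = E ℕ.+ B ℕ.* suc E , r , dominates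
  where
  r : _ → ℕ
  r i = suc B ℕ.* suc (q i) ℕ.∸ m i
  m≤Nq : ∀ i → m i ≤ suc B ℕ.* suc (q i)
  m≤Nq i = ℕ.≤-trans (m≤B i) (ℕ.≤-trans (ℕ.n≤1+n B) (ℕ.m≤m*n (suc B) (suc (q i))))
  dominates : ∀ i → ι (suc B ℕ.* suc E) * c i ≡ ι (m i ℕ.+ r i)
  dominates i = trans (multiplier-scale (suc B) (suc E) (suc (q i)) (hq i))
                      (cong ι (sym (ℕ.m+[n∸m]≡n (m≤Nq i))))

⊕-assoc : ∀ {n} (u v w : ℚⁿ n) → (u ⊕ v) ⊕ w ≡ u ⊕ (v ⊕ w)
⊕-assoc = zipWith-assoc +-assoc

⊕-identityˡ : ∀ {n} (u : ℚⁿ n) → 𝟎 ⊕ u ≡ u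
⊕-identityˡ = zipWith-identityˡ +-identityˡ

⊕-identityʳ : ∀ {n} (u : ℚⁿ n) → u ⊕ 𝟎 ≡ u
⊕-identityʳ = zipWith-identityʳ +-identityʳ

⊕-interchange : ∀ {n} (u v w z : ℚⁿ n) → (u ⊕ v) ⊕ (w ⊕ z) ≡ (u ⊕ w) ⊕ (v ⊕ z)
⊕-interchange []      []      []      []      = refl
⊕-interchange (a ∷ u) (b ∷ v) (c ∷ w) (d ∷ z) =
  cong₂ _∷_ (interchange a b c d) (⊕-interchange u v w z)
  where open CommSemigroupProperties (CommutativeMonoid.commutativeSemigroup +-0-commutativeMonoid)

⊙-distribˡ : ∀ {n} c (u v : ℚⁿ n) → c ⊙ (u ⊕ v) ≡ c ⊙ u ⊕ c ⊙ v
⊙-distribˡ c []      []      = refl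
⊙-distribˡ c (x ∷ u) (y ∷ v) = cong₂ _∷_ (*-distribˡ-+ c x y) (⊙-distribˡ c u v)

⊙-distribʳ : ∀ {n} c d (u : ℚⁿ n) → (c + d) ⊙ u ≡ c ⊙ u ⊕ d ⊙ u
⊙-distribʳ c d []      = refl
⊙-distribʳ c d (x ∷ u) = cong₂ _∷_ (*-distribʳ-+ x c d) (⊙-distribʳ c d u)

⊙-assoc : ∀ {n} c d (u : ℚⁿ n) → c ⊙ (d ⊙ u) ≡ (c * d) ⊙ u
⊙-assoc c d u = trans (sym (map-∘ (c *_) (d *_) u)) (map-cong (λ x → sym (*-assoc c d x)) u)

⊙-identity : ∀ {n} (u : ℚⁿ n) → 1ℚ ⊙ u ≡ u
⊙-identity u = trans (map-cong *-identityˡ u) (map-id u)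

⊙-zeroˡ : ∀ {n} (u : ℚⁿ n) → 0ℚ ⊙ u ≡ 𝟎
⊙-zeroˡ u = trans (map-cong *-zeroˡ u) (map-const u 0ℚ)

⊙-zeroʳ : ∀ {n} c → c ⊙ 𝟎 {n} ≡ 𝟎
⊙-zeroʳ {n} c = trans (map-replicate (c *_) 0ℚ n) (cong (replicate n) (*-zeroʳ c))

·-as-⊙ : ∀ {n} m (u : ℚⁿ n) → m · u ≡ ι m ⊙ u
·-as-⊙ zero    u = sym (⊙-zeroˡ u)
·-as-⊙ (suc m) u = trans (cong₂ _⊕_ (sym (⊙-identity u)) (·-as-⊙ m u)) (sym (⊙-distribʳ 1ℚ (ι m) u))

⊙-cancel : ∀ {n} r .{{_ : NonZero r}} {a b : ℚⁿ n} → r ⊙ a ≡ b → a ≡ (1/ r) ⊙ b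
⊙-cancel r {a} {b} eq = begin
  a                  ≡⟨ sym (⊙-identity a) ⟩
  1ℚ ⊙ a             ≡⟨ cong (_⊙ a) (sym (*-inverseˡ r)) ⟩
  (1/ r * r) ⊙ a     ≡⟨ sym (⊙-assoc (1/ r) r a) ⟩
  (1/ r) ⊙ (r ⊙ a)   ≡⟨ cong ((1/ r) ⊙_) eq ⟩
  (1/ r) ⊙ b         ∎

lin : ∀ {n k} → (Fin k → ℚⁿ n) → (Fin k → ℚ) → ℚⁿ n
lin p c = Σᵥ (λ i → c i ⊙ p i)

lin-cong : ∀ {n k} (p : Fin k → ℚⁿ n) {c d : Fin k → ℚ} → (∀ i → c i ≡ d i) → lin p c ≡ lin p d
lin-cong {k = zero}  p eq = refl
lin-cong {k = suc k} p eq = cong₂ _⊕_ (cong (_⊙ p fzero) (eq fzero))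
                                      (lin-cong (λ i → p (fsuc i)) (λ i → eq (fsuc i)))

lin-zero : ∀ {n k} (p : Fin k → ℚⁿ n) → lin p (const 0ℚ) ≡ 𝟎
lin-zero {k = zero}  p = refl
lin-zero {k = suc k} p = trans (cong₂ _⊕_ (⊙-zeroˡ (p fzero)) (lin-zero (λ i → p (fsuc i))))
                               (⊕-identityˡ 𝟎)

lin-+ : ∀ {n k} (p : Fin k → ℚⁿ n) (c d : Fin k → ℚ) →
  lin p (λ i → c i + d i) ≡ lin p c ⊕ lin p d
lin-+ {k = zero}  p c d = sym (⊕-identityˡ 𝟎)
lin-+ {k = suc k} p c d = begin
  (c₀ + d₀) ⊙ p₀ ⊕ lin p′ (λ i → c′ i + d′ i)      ≡⟨ cong₂ _⊕_ (⊙-distribʳ c₀ d₀ p₀) (lin-+ p′ c′ d′) ⟩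
  (c₀ ⊙ p₀ ⊕ d₀ ⊙ p₀) ⊕ (lin p′ c′ ⊕ lin p′ d′)    ≡⟨ ⊕-interchange (c₀ ⊙ p₀) (d₀ ⊙ p₀) (lin p′ c′) (lin p′ d′) ⟩
  (c₀ ⊙ p₀ ⊕ lin p′ c′) ⊕ (d₀ ⊙ p₀ ⊕ lin p′ d′)    ∎
  where
  p₀ = p fzero; c₀ = c fzero; d₀ = d fzero
  p′ = λ i → p (fsuc i); c′ = λ i → c (fsuc i); d′ = λ i → d (fsuc i)

lin-scale : ∀ {n k} (p : Fin k → ℚⁿ n) r (c : Fin k → ℚ) → r ⊙ lin p c ≡ lin p (λ i → r * c i)
lin-scale {k = zero}  p r c = ⊙-zeroʳ r
lin-scale {k = suc k} p r c = begin
  r ⊙ (c fzero ⊙ p fzero ⊕ lin p′ c′)         ≡⟨ ⊙-distribˡ r (c fzero ⊙ p fzero) (lin p′ c′) ⟩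
  r ⊙ (c fzero ⊙ p fzero) ⊕ r ⊙ lin p′ c′     ≡⟨ cong₂ _⊕_ (⊙-assoc r (c fzero) (p fzero)) (lin-scale p′ r c′) ⟩
  (r * c fzero) ⊙ p fzero ⊕ lin p′ (λ i → r * c′ i)  ∎
  where
  p′ = λ i → p (fsuc i); c′ = λ i → c (fsuc i)

natComb : ∀ {n k} → (Fin k → ℚⁿ n) → (Fin k → ℕ) → ℚⁿ n
natComb p m = lin p (λ i → ι (m i))

natComb-+ : ∀ {n k} (p : Fin k → ℚⁿ n) (m r : Fin k → ℕ) →
  natComb p (λ i → m i ℕ.+ r i) ≡ natComb p m ⊕ natComb p r
natComb-+ p m r = trans (lin-cong p (λ i → ι-+ (m i) (r i))) (lin-+ p (λ i → ι (m i)) (λ i → ι (r i)))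

basis : ∀ {k} → Fin k → Fin k → ℕ
basis fzero    fzero    = 1
basis fzero    (fsuc _) = 0
basis (fsuc _) fzero    = 0
basis (fsuc i) (fsuc j) = basis i j

natComb-basis : ∀ {n k} (p : Fin k → ℚⁿ n) i → natComb p (basis i) ≡ p i
natComb-basis {k = suc k} p fzero = begin
  (1ℚ + 0ℚ) ⊙ p fzero ⊕ lin p′ (const 0ℚ)   ≡⟨ cong₂ _⊕_ (⊙-identity (p fzero)) (lin-zero p′) ⟩
  p fzero ⊕ 𝟎                               ≡⟨ ⊕-identityʳ (p fzero) ⟩
  p fzero                                   ∎
  where p′ = λ i → p (fsuc i)
natComb-basis {k = suc k} p (fsuc i) =
  trans (cong (_⊕ natComb p′ (basis i)) (⊙-zeroˡ (p fzero)))
        (trans (⊕-identityˡ _) (natComb-basis p′ i))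
  where p′ = λ i → p (fsuc i)

Star-⊕ : ∀ {n k} {p : Fin k → ℚⁿ n} {x y} → Star p x → Star p y → Star p (x ⊕ y)
Star-⊕ {y = y} star-zero sy = subst (Star _) (sym (⊕-identityˡ y)) sy
Star-⊕ {p = p} {y = y} (star-add i {x} sx) sy =
  subst (Star _) (sym (⊕-assoc (p i) x y)) (star-add i (Star-⊕ sx sy))

Star-tail : ∀ {n k} {p : Fin (suc k) → ℚⁿ n} {x} → Star (λ i → p (fsuc i)) x → Star p x
Star-tail star-zero      = star-zero
Star-tail (star-add i s) = star-add (fsuc i) (Star-tail s)

Star-multiple : ∀ {n k} {p : Fin k → ℚⁿ n} m i → Star p (m · p i)
Star-multiple zero    i = star-zero
Star-multiple (suc m) i = star-add i (Star-multiple m i)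

natComb∈Star : ∀ {n k} (p : Fin k → ℚⁿ n) (m : Fin k → ℕ) → Star p (natComb p m)
natComb∈Star {k = zero}  p m = star-zero
natComb∈Star {k = suc k} p m =
  Star-⊕ (subst (Star p) (·-as-⊙ (m fzero) (p fzero)) (Star-multiple (m fzero) fzero))
         (Star-tail (natComb∈Star (λ i → p (fsuc i)) (λ i → m (fsuc i))))

Star⇒natComb : ∀ {n k} {p : Fin k → ℚⁿ n} {x} → Star p x → ∃ λ m → x ≡ natComb p m
Star⇒natComb {p = p} star-zero = const 0 , sym (lin-zero p)
Star⇒natComb {p = p} (star-add i {x} s) with Star⇒natComb s
... | m , x≡ = (λ j → basis i j ℕ.+ m j) , (begin
  p i ⊕ x                               ≡⟨ cong₂ _⊕_ (sym (natComb-basis p i)) x≡ ⟩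
  natComb p (basis i) ⊕ natComb p m     ≡⟨ sym (natComb-+ p (basis i) m) ⟩
  natComb p (λ j → basis i j ℕ.+ m j)   ∎)

-- Interior vectors have strictly positive coordinates: test the definition on
-- x = Σᵢ pᵢ to get N·a = Σᵢ (1 + mᵢ) pᵢ, then divide by N.
interior⇒PosCone : ∀ {n k} {p : Fin k → ℚⁿ n} {a} → Interior (Star p) a → PosCone p a
interior⇒PosCone {p = p} {a} (_ , interior)
  with interior (natComb p (const 1)) (natComb∈Star p (const 1))
... | suc N , _ , y , y∈P* , Na≡ with Star⇒natComb y∈P*
... | m , y≡ = c , c>0 , a≡
  where
  instance
    ιN≢0 : NonZero (ι (suc N))
    ιN≢0 = pos⇒nonZero (ι (suc N)) {{ι-suc-pos N}}
  c : _ → ℚ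
  c i = 1/ ι (suc N) * ι (suc (m i))
  c>0 : ∀ i → 0ℚ < c i
  c>0 i = positive⁻¹ (c i) {{pos*pos⇒pos (1/ ι (suc N)) {{1/pos⇒pos (ι (suc N)) {{ι-suc-pos N}}}}
                                         (ι (suc (m i))) {{ι-suc-pos (m i)}}}}
  ιN·a≡ : ι (suc N) ⊙ a ≡ natComb p (λ i → suc (m i))
  ιN·a≡ = begin
    ι (suc N) ⊙ a                        ≡⟨ sym (·-as-⊙ (suc N) a) ⟩
    suc N · a                            ≡⟨ Na≡ ⟩
    natComb p (const 1) ⊕ y              ≡⟨ cong (natComb p (const 1) ⊕_) y≡ ⟩
    natComb p (const 1) ⊕ natComb p m    ≡⟨ sym (natComb-+ p (const 1) m) ⟩
    natComb p (λ i → suc (m i))          ∎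
  a≡ : a ≡ lin p c
  a≡ = trans (⊙-cancel (ι (suc N)) ιN·a≡) (lin-scale p (1/ ι (suc N)) (λ i → ι (suc (m i))))

-- Conversely, a ∈ P* with positive coordinates c is interior: for x = Σᵢ mᵢ pᵢ
-- choose N with N·cᵢ = mᵢ + rᵢ, so that N·a = x + Σᵢ rᵢ pᵢ.
PosCone⇒interior : ∀ {n k} {p : Fin k → ℚⁿ n} {a} → Star p a → PosCone p a → Interior (Star p) a
PosCone⇒interior {p = p} {a} a∈P* (c , c>0 , a≡) = a∈P* , absorbs
  where
  absorbs : ∀ x → Star p x → ∃ λ N → N ≥ 1 × ∃ λ y → Star p y × (N · a ≡ x ⊕ y)
  absorbs x x∈P* with Star⇒natComb x∈P*
  ... | m , x≡ with dominating-multiple c c>0 m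
  ... | N , r , Nc≡ = suc N , s≤s z≤n , natComb p r , natComb∈Star p r , (begin
    suc N · a                              ≡⟨ ·-as-⊙ (suc N) a ⟩
    ι (suc N) ⊙ a                          ≡⟨ cong (ι (suc N) ⊙_) a≡ ⟩
    ι (suc N) ⊙ lin p c                    ≡⟨ lin-scale p (ι (suc N)) c ⟩
    lin p (λ i → ι (suc N) * c i)          ≡⟨ lin-cong p Nc≡ ⟩
    natComb p (λ i → m i ℕ.+ r i)          ≡⟨ natComb-+ p m r ⟩
    natComb p m ⊕ natComb p r              ≡⟨ cong (_⊕ natComb p r) (sym x≡) ⟩
    x ⊕ natComb p r                        ∎)

interior-of-Star : ∀ {n k} (p : Fin k → ℚⁿ n) → Interior (Star p) ≐ (λ x → Star p x × PosCone p x)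
interior-of-Star p a = mk⇔ (λ a° → proj₁ a° , interior⇒PosCone a°)
                           (λ { (a∈P* , a∈cone) → PosCone⇒interior a∈P* a∈cone })

-- With no generators the positive cone is {0}, hence so is the interior.
interior-of-trivial : ∀ {n} (p : Fin 0 → ℚⁿ n) → Interior (Star p) ≐ (λ x → x ≡ 𝟎)
interior-of-trivial p a = mk⇔
  (λ a° → proj₂ (proj₂ (proj₂ (Equivalence.to (interior-of-Star p a) a°))))
  (λ { refl → Equivalence.from (interior-of-Star p 𝟎) (star-zero , (λ ()) , (λ ()) , refl) })

lemma4p2 : (n k : ℕ) (p : Fin k → ℚⁿ n) →
    (k ≡ 0 → Interior (Star p) ≐ (λ x → x ≡ 𝟎)) ×
    (k ≥ 1 → Interior (Star p) ≐ (λ x → Star p x × PosCone p x))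
lemma4p2 n k p = (λ { refl → interior-of-trivial p }) , (λ _ → interior-of-Star p)
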